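{- For integers $q\ge1$, $k\ge 0$ and $d$, define \[ S_{q,d,k}=\sum_{\substack{k_1+\cdots+k_q=k\\ \forall j,\ 0\le k_j\le k-d}}\frac{\prod_{j=1}^{q}(2k_j-1)!!}{(2k-1)!!}. \] For any fixed integer $d\ge 0$, for all sufficiently large $k$ and all $q$ with $1\le q\le k$, we have $S_{q,k-d,k}\le 2^{ -k}$.
   Context: $(2j-1)!!=\frac{(2j)!}{2^jj!}$ for $j\ge0$; in particular $(-1)!!=1$. The sum runs over tuples $(k_1,\dots,k_q)$ of integers. -}

module Defs where

open import Data.Nat using (ℕ; zero; suc; _+_; _*_; _∸_; _^_; _≤_; _≤?_; NonZero; _≟_)
open import Data.Nat.Properties using (m*n≢0; m^n≢0)
open import Data.Integer using (+_)
open import Data.Rational using (ℚ; _/_)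
open import Data.List using (List; []; _∷_; [_]; map; concatMap; upTo; filter)
open import Data.Nat.ListAction using (sum)
open import Data.Vec as Vec using (Vec)
open import Data.Vec.Relation.Unary.All as VAll using (All)
open import Data.Product using (_×_)
open import Relation.Binary.PropositionalEquality using (_≡_)
open import Relation.Nullary.Decidable using (Dec; _×-dec_)

-- oddDF j = (2j-1)!!, so oddDF 0 = (-1)!! = 1 and (2j+1)!! = (2j+1)·(2j-1)!!.
oddDF : ℕ → ℕ
oddDF zero = 1
oddDF (suc j) = suc (2 * j) * oddDF j

oddDF-nonZero : ∀ j → NonZero (oddDF j)
oddDF-nonZero zero = _
oddDF-nonZero (suc j) = m*n≢0 (suc (2 * j)) (oddDF j) {{_}} {{oddDF-nonZero j}}

inv2^ : ℕ → ℚ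
inv2^ k = (+ 1) / (2 ^ k)  where instance _ = m^n≢0 2 k

allVecs : (q n : ℕ) → List (Vec ℕ q)
allVecs zero n = [ Vec.[] ]
allVecs (suc q) n = concatMap (λ x → map (x Vec.∷_) (allVecs q n)) (upTo (suc n))

-- summation range of S_{q,d,k}: k_1+…+k_q = k and k_j ≤ k - d (k_j ≥ 0 automatic in ℕ)
Admissible : (q d k : ℕ) → Vec ℕ q → Set
Admissible q d k v = (Vec.sum v ≡ k) × All (λ x → x ≤ k ∸ d) v

admissible? : (q d k : ℕ) → (v : Vec ℕ q) → Dec (Admissible q d k v)
admissible? q d k v = (Vec.sum v ≟ k) ×-dec VAll.all? (λ x → x ≤? k ∸ d) v

-- every tuple in the range has entries ≤ k, so enumerating allVecs q k suffices
numerS : (q d k : ℕ) → ℕ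
numerS q d k = sum (map (λ v → Vec.foldr _ (λ x acc → oddDF x * acc) 1 v) (filter (admissible? q d k) (allVecs q k)))

S : (q d k : ℕ) → ℚ
S q d k = (+ numerS q d k) / oddDF k  where instance _ = oddDF-nonZero k

module Submission where

-- In S_{q,k-d,k} every admissible tuple has entries k_j ≤ k - (k - d) ≤ d,
-- so each summand's numerator is at most ((2d-1)!!)^q, and there are at most
-- (d+1)^q such tuples.  Hence the numerator of S is at most C^q ≤ C^k with
-- C = (d+1)·(2d-1)!!, a constant, while the denominator (2k-1)!! grows
-- super-exponentially.  Concretely, (2C)^k ≤ (2k-1)!! once k ≥ 2·(2C)², which
-- is exactly numerator · 2^k ≤ (2k-1)!!, i.e. S ≤ 2^{-k}.

open import Defs
open import Data.Nat using (ℕ; _≤_; _^_)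
open import Data.Nat as ℕ using (_∸_)
open import Data.Rational as ℚ using ()
open import Data.Product using (∃-syntax)

open import Data.Nat using (zero; suc; _+_; _*_; z≤n; s≤s; _≤?_; NonZero; >-nonZero⁻¹)
open import Data.Nat.Properties
open import Data.Nat.ListAction using (sum)
open import Data.Nat.ListAction.Properties using (sum-++)
open import Data.Nat.Solver using (module +-*-Solver)
open import Data.Integer as ℤ using (+≤+)
import Data.Integer.Properties as ℤP
open import Data.Rational.Unnormalised using (mkℚᵘ; *≤*)
import Data.Rational.Unnormalised.Properties as ℚᵘP
import Data.Rational.Properties as ℚP
open import Data.List using (List; []; _∷_; _++_; map; concatMap; upTo; applyUpTo; filter)
open import Data.List.Properties using (map-++; map-upTo)
open import Data.Vec as Vec using (Vec)
open import Data.Vec.Relation.Unary.All as VAll using (All)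
open import Data.Product using (_,_)
open import Data.Sum using (inj₁; inj₂)
open import Data.Empty using (⊥-elim)
open import Function using (_∘_)
open import Relation.Binary.PropositionalEquality
open import Relation.Nullary using (yes; no)
open import Relation.Unary using (Pred; Decidable)

frac-≤ : ∀ a b c e .{{_ : NonZero b}} .{{_ : NonZero e}} → a * e ≤ c * b →
         (ℤ.+ a) ℚ./ b ℚ.≤ (ℤ.+ c) ℚ./ e
frac-≤ a (suc b) c (suc e) ae≤cb = ℚP.toℚᵘ-cancel-≤
  (ℚᵘP.≤-respʳ-≃ (ℚᵘP.≃-sym (ℚP.toℚᵘ-fromℚᵘ (mkℚᵘ (ℤ.+ c) e)))
    (ℚᵘP.≤-respˡ-≃ (ℚᵘP.≃-sym (ℚP.toℚᵘ-fromℚᵘ (mkℚᵘ (ℤ.+ a) b)))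
      (*≤* (subst₂ ℤ._≤_ (ℤP.pos-* a (suc e)) (ℤP.pos-* c (suc b)) (+≤+ ae≤cb)))))

*-^-distrib : ∀ a b k → (a * b) ^ k ≡ a ^ k * b ^ k
*-^-distrib a b zero    = refl
*-^-distrib a b (suc k) = begin
  a * b * (a * b) ^ k       ≡⟨ cong (a * b *_) (*-^-distrib a b k) ⟩
  a * b * (a ^ k * b ^ k)   ≡⟨ solve 4 (λ a b x y → a :* b :* (x :* y) := a :* x :* (b :* y))
                                 refl a b (a ^ k) (b ^ k) ⟩
  a * a ^ k * (b * b ^ k)   ∎
  where open ≡-Reasoning
        open +-*-Solver

oddDF-mono : ∀ {x y} → x ≤ y → oddDF x ≤ oddDF y
oddDF-mono {x} {zero}  z≤n = ≤-refl
oddDF-mono {x} {suc y} x≤y with m≤n⇒m<n∨m≡n x≤y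
... | inj₁ (s≤s x≤y') = ≤-trans (oddDF-mono x≤y') (m≤n*m (oddDF y) (suc (2 * y)))
... | inj₂ refl = ≤-refl

-- Super-exponential growth: each factor 2j+1 with j ≥ B² is at least B², so
-- going from (2(B²+n)-1)!! to the next double factorial multiplies by ≥ B².
oddDF-grows : ∀ B n → B ^ (n + n) ≤ oddDF (B * B + n)
oddDF-grows B zero    = >-nonZero⁻¹ (oddDF (B * B + 0)) {{oddDF-nonZero (B * B + 0)}}
oddDF-grows B (suc n) = begin
  B ^ (suc n + suc n)                         ≡⟨ cong (λ e → B * B ^ e) (+-suc n n) ⟩
  B * (B * B ^ (n + n))                       ≡⟨ *-assoc B B _ ⟨
  B * B * B ^ (n + n)                         ≤⟨ *-mono-≤ B²≤factor (oddDF-grows B n) ⟩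
  suc (2 * (B * B + n)) * oddDF (B * B + n)   ≡⟨ cong oddDF (+-suc (B * B) n) ⟨
  oddDF (B * B + suc n)                       ∎
  where
  open ≤-Reasoning
  B²≤factor : B * B ≤ suc (2 * (B * B + n))
  B²≤factor = ≤-trans (m≤m+n (B * B) n) (≤-trans (m≤n*m (B * B + n) 2) (n≤1+n _))

pow≤oddDF : ∀ B .{{_ : NonZero B}} k → B * B + B * B ≤ k → B ^ k ≤ oddDF k
pow≤oddDF B k 2B²≤k = begin
  B ^ k               ≡⟨ cong (B ^_) k≡B²+n ⟨
  B ^ (B * B + n)     ≤⟨ ^-monoʳ-≤ B (+-monoˡ-≤ n B²≤n) ⟩
  B ^ (n + n)         ≤⟨ oddDF-grows B n ⟩
  oddDF (B * B + n)   ≡⟨ cong oddDF k≡B²+n ⟩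
  oddDF k             ∎
  where
  open ≤-Reasoning
  n = k ∸ B * B
  k≡B²+n : B * B + n ≡ k
  k≡B²+n = m+[n∸m]≡n (≤-trans (m≤m+n (B * B) (B * B)) 2B²≤k)
  B²≤n : B * B ≤ n
  B²≤n = +-cancelˡ-≤ (B * B) (B * B) n (subst (B * B + B * B ≤_) (sym k≡B²+n) 2B²≤k)

prodWith : (ℕ → ℕ) → ∀ {q} → Vec ℕ q → ℕ
prodWith f = Vec.foldr _ (λ x acc → f x * acc) 1

prodWith-mono : ∀ {p} {P : Pred ℕ p} (f g : ℕ → ℕ) → (∀ x → P x → f x ≤ g x) →
                ∀ {q} (v : Vec ℕ q) → All P v → prodWith f v ≤ prodWith g v
prodWith-mono f g f≤g Vec.[]       All.[]         = ≤-refl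
prodWith-mono f g f≤g (x Vec.∷ v) (px All.∷ pv) =
  *-mono-≤ (f≤g x px) (prodWith-mono f g f≤g v pv)

sum-prefixed : ∀ f {q} x (vs : List (Vec ℕ q)) →
  sum (map (prodWith f) (map (x Vec.∷_) vs)) ≡ f x * sum (map (prodWith f) vs)
sum-prefixed f x []       = sym (*-zeroʳ (f x))
sum-prefixed f x (v ∷ vs) = trans (cong (f x * prodWith f v +_) (sum-prefixed f x vs))
  (sym (*-distribˡ-+ (f x) (prodWith f v) (sum (map (prodWith f) vs))))

sum-prefixedAll : ∀ f {q} (vs : List (Vec ℕ q)) (xs : List ℕ) →
  sum (map (prodWith f) (concatMap (λ x → map (x Vec.∷_) vs) xs))
    ≡ sum (map f xs) * sum (map (prodWith f) vs)
sum-prefixedAll f vs []       = refl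
sum-prefixedAll f vs (x ∷ xs) = begin
  sum (map W (map (x Vec.∷_) vs ++ rest))
    ≡⟨ cong sum (map-++ W (map (x Vec.∷_) vs) rest) ⟩
  sum (map W (map (x Vec.∷_) vs) ++ map W rest)
    ≡⟨ sum-++ (map W (map (x Vec.∷_) vs)) (map W rest) ⟩
  sum (map W (map (x Vec.∷_) vs)) + sum (map W rest)
    ≡⟨ cong₂ _+_ (sum-prefixed f x vs) (sum-prefixedAll f vs xs) ⟩
  f x * sum (map W vs) + sum (map f xs) * sum (map W vs)
    ≡⟨ *-distribʳ-+ (sum (map W vs)) (f x) (sum (map f xs)) ⟨
  (f x + sum (map f xs)) * sum (map W vs) ∎
  where
  open ≡-Reasoning
  W = prodWith f
  rest = concatMap (λ x → map (x Vec.∷_) vs) xs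

sum-allVecs : ∀ f q n →
  sum (map (prodWith f) (allVecs q n)) ≡ sum (map f (upTo (suc n))) ^ q
sum-allVecs f zero    n = refl
sum-allVecs f (suc q) n = trans (sum-prefixedAll f (allVecs q n) (upTo (suc n)))
  (cong (sum (map f (upTo (suc n))) *_) (sum-allVecs f q n))

sum-filter≤ : ∀ {p} {A : Set} {P : Pred A p} (P? : Decidable P) (f g : A → ℕ) →
  (∀ x → P x → f x ≤ g x) → ∀ xs → sum (map f (filter P? xs)) ≤ sum (map g xs)
sum-filter≤ P? f g f≤g []       = ≤-refl
sum-filter≤ P? f g f≤g (x ∷ xs) with P? x
... | yes px = +-mono-≤ (f≤g x px) (sum-filter≤ P? f g f≤g xs)
... | no _   = ≤-trans (sum-filter≤ P? f g f≤g xs) (m≤n+m _ (g x))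

sum-supported≤ : ∀ f c d m → (∀ x → f x ≤ c) → (∀ x → d ≤ x → f x ≡ 0) →
                 sum (applyUpTo f m) ≤ d * c
sum-supported≤ f c d       zero    f≤c f-vanishes = z≤n
sum-supported≤ f c zero    (suc m) f≤c f-vanishes rewrite f-vanishes 0 z≤n =
  sum-supported≤ (f ∘ suc) c zero m (f≤c ∘ suc) (λ x _ → f-vanishes (suc x) z≤n)
sum-supported≤ f c (suc d) (suc m) f≤c f-vanishes =
  +-mono-≤ (f≤c 0) (sum-supported≤ (f ∘ suc) c d m (f≤c ∘ suc) (λ x → f-vanishes (suc x) ∘ s≤s))

-- The truncated weight: (2d-1)!! on [0,d] and 0 beyond.  It dominates (2x-1)!!
-- on [0,d], and its total mass over any initial segment is at most (d+1)·(2d-1)!!.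
truncated : ℕ → ℕ → ℕ
truncated d x with x ≤? d
... | yes _ = oddDF d
... | no _  = 0

truncated-≤ : ∀ d x → truncated d x ≤ oddDF d
truncated-≤ d x with x ≤? d
... | yes _ = ≤-refl
... | no _  = z≤n

truncated-vanishes : ∀ d x → suc d ≤ x → truncated d x ≡ 0
truncated-vanishes d x d<x with x ≤? d
... | yes x≤d = ⊥-elim (<⇒≱ d<x x≤d)
... | no _    = refl

oddDF≤truncated : ∀ d x → x ≤ d → oddDF x ≤ truncated d x
oddDF≤truncated d x x≤d with x ≤? d
... | yes _   = oddDF-mono x≤d
... | no x≰d  = ⊥-elim (x≰d x≤d)

sum-truncated≤ : ∀ d m → sum (map (truncated d) (upTo m)) ≤ suc d * oddDF d
sum-truncated≤ d m = subst (_≤ suc d * oddDF d) (cong sum (sym (map-upTo (truncated d) m)))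
  (sum-supported≤ (truncated d) (oddDF d) (suc d) m (truncated-≤ d) (truncated-vanishes d))

bound : ℕ → ℕ
bound d = suc d * oddDF d

bound-nonZero : ∀ d → NonZero (bound d)
bound-nonZero d = m*n≢0 (suc d) (oddDF d) {{_}} {{oddDF-nonZero d}}

-- Numerator estimate: Σ ∏_j (2k_j-1)!! over the range of S_{q,k-d,k} is ≤ C^q.
-- Admissible tuples have entries ≤ k ∸ (k ∸ d) ≤ d, where (2x-1)!! ≤ truncated d x.
numerS≤ : ∀ d q k → numerS q (k ∸ d) k ≤ bound d ^ q
numerS≤ d q k = begin
  numerS q (k ∸ d) k
    ≤⟨ sum-filter≤ (admissible? q (k ∸ d) k) (prodWith oddDF) (prodWith (truncated d))
         (λ v (_ , entries≤) → prodWith-mono oddDF (truncated d) (oddDF≤truncated d) v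
            (VAll.map (λ x≤ → ≤-trans x≤ k∸[k∸d]≤d) entries≤))
         (allVecs q k) ⟩
  sum (map (prodWith (truncated d)) (allVecs q k))
    ≡⟨ sum-allVecs (truncated d) q k ⟩
  sum (map (truncated d) (upTo (suc k))) ^ q
    ≤⟨ ^-monoˡ-≤ q (sum-truncated≤ d (suc k)) ⟩
  bound d ^ q ∎
  where
  open ≤-Reasoning
  k∸[k∸d]≤d : k ∸ (k ∸ d) ≤ d
  k∸[k∸d]≤d = m≤n+o⇒m∸n≤o k (k ∸ d) (subst (k ≤_) (+-comm d (k ∸ d)) (m≤n+m∸n k d))

-- The theorem: with B = 2C, any K ≥ 2B² works, since for q ≤ k
-- numerator · 2^k ≤ C^q · 2^k ≤ (2C)^k ≤ (2k-1)!!.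
lemma21 : (d : ℕ) → ∃[ K ] ((k q : ℕ) → K ≤ k → 1 ≤ q → q ≤ k →
              S q (k ∸ d) k ℚ.≤ inv2^ k)
lemma21 d = B * B + B * B , λ k q K≤k _ q≤k →
  frac-≤ (numerS q (k ∸ d) k) (oddDF k) 1 (2 ^ k)
    {{oddDF-nonZero k}} {{m^n≢0 2 k}} (numerator·2^k≤ k q K≤k q≤k)
  where
  B = bound d * 2
  instance
    C-nonZero : NonZero (bound d)
    C-nonZero = bound-nonZero d
    B-nonZero : NonZero B
    B-nonZero = m*n≢0 (bound d) 2
  numerator·2^k≤ : ∀ k q → B * B + B * B ≤ k → q ≤ k →
                   numerS q (k ∸ d) k * 2 ^ k ≤ 1 * oddDF k
  numerator·2^k≤ k q K≤k q≤k = begin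
    numerS q (k ∸ d) k * 2 ^ k   ≤⟨ *-monoˡ-≤ (2 ^ k) (numerS≤ d q k) ⟩
    bound d ^ q * 2 ^ k          ≤⟨ *-monoˡ-≤ (2 ^ k) (^-monoʳ-≤ (bound d) q≤k) ⟩
    bound d ^ k * 2 ^ k          ≡⟨ *-^-distrib (bound d) 2 k ⟨
    B ^ k                        ≤⟨ pow≤oddDF B k K≤k ⟩
    oddDF k                      ≡⟨ *-identityˡ (oddDF k) ⟨
    1 * oddDF k                  ∎
    where open ≤-Reasoning
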